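{- For integers $0\le k\le m$, let $C(m,k)=\binom mk$ (the number of parsimonious games with $m+4$ players and $k+2$ types), let $\Gamma(m,k)$ be the number of self twin parsimonious games with $n=m+4$ players and $h=k+2$ types, and let $\Delta(m,k)=C(m,k)-\Gamma(m,k)$ be the number of non self twin ones. Then $\Delta(m,0)=\Delta(m,m)=0$ for every $m$; and for $m\ge 2$, $k=1,\dots,m-1$: if $m+k$ is even then $\Delta(m,k)=\Delta(m-1,k)+\Delta(m-1,k-1)$, and if $m+k$ is odd then $\Delta(m,k)=\Delta(m-1,k)+\Delta(m-1,k-1)+2\Gamma(m-1,k-1)$.
   Context: A simple game on $N=\{1,\dots,n\}$ is a map $v:2^N\to\{0,1\}$; it is constant sum if $v(S)+v(N\setminus S)=1$ for all $S$; $S$ is minimal winning if $v(S)=1$ and no proper subset is winning. A weighted majority game has a representation $(q;\mathbf w)$ with positive weights and $v(S)=1\iff\sum_{i\in S}w_i\ge q$; it is homogeneous if $\sum_{i\in S}w_i=q$ for every minimal winning $S$. Constant-sum homogeneous weighted majority games without dummies and without dictator have a unique minimal homogeneous representation with integer weights $1=w_1\le\dots\le w_n$, $q=(1+\sum_iw_i)/2$. A parsimonious (P) game is such a game with exactly $n$ minimal winning coalitions. Its binary representation is $\mathbf b\in\{0,1\}^n$ with $b_1=1$ and $b_i=1$ iff $w_i>w_{i-1}$ ($i\ge2$). Known fact: in every P game $b_1=1,b_2=0,b_{n-1}=0,b_n=1$, and $G\mapsto(b_3,\dots,b_{n-2})$ is a bijection from $n$-player P games onto $\{0,1\}^{n-4}$.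 The number of types $h$ is the number of $1$'s in $\mathbf b$. A P game is self twin if $b_i=b_{n+1-i}$ for all $i=3,\dots,n-2$. -}

module Defs where

open import Data.Bool using (Bool; true; false)
open import Data.Bool.Properties using () renaming (_≟_ to _≟B_)
open import Data.Nat using (ℕ; zero; suc; _+_; _∸_; _≤_; _≤?_)
open import Data.Nat.Combinatorics using (_C_)
open import Data.Fin using (Fin; toℕ; opposite)
open import Data.Fin.Properties using (all?)
open import Data.Vec using (Vec; []; _∷_; _++_; lookup)
open import Data.List using (List; []; _∷_; map; concatMap; filter; length)
open import Data.Integer using (ℤ; +_; _-_)
open import Data.Product using (_×_)
open import Relation.Binary.PropositionalEquality using (_≡_)
open import Relation.Nullary using (Dec)
open import Relation.Nullary.Decidable using (_→-dec_; _×-dec_)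
import Data.Nat.Properties as ℕP

-- Number of players of a P game with m free middle bits: n = m + 4
-- (written 2 + (m + 2) so that the binary representation below typechecks).
players : ℕ → ℕ
players m = 2 + (m + 2)

allVecs : (m : ℕ) → List (Vec Bool m)
allVecs zero    = [] ∷ []
allVecs (suc m) = concatMap (λ v → (false ∷ v) ∷ (true ∷ v) ∷ []) (allVecs m)

-- Binary representation b ∈ {0,1}^n of the P game corresponding, via the known
-- bijection, to the middle bits (b_3,…,b_{n-2}): b_1 = 1, b_2 = 0, b_{n-1} = 0, b_n = 1.
binRep : {m : ℕ} → Vec Bool m → Vec Bool (players m)
binRep mid = true ∷ false ∷ (mid ++ (false ∷ true ∷ []))

numOnes : {n : ℕ} → Vec Bool n → ℕ
numOnes []           = 0
numOnes (true  ∷ bs) = suc (numOnes bs)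
numOnes (false ∷ bs) = numOnes bs

-- Self twin: b_i = b_{n+1-i} for all players i = 3,…,n-2.
-- Fin index j stands for player i = 1 + toℕ j; opposite j stands for player n+1-i.
SelfTwin : {n : ℕ} → Vec Bool n → Set
SelfTwin {n} b = ∀ (j : Fin n) → 3 ≤ suc (toℕ j) → suc (toℕ j) ≤ n ∸ 2 →
                 lookup b j ≡ lookup b (opposite j)

selfTwin? : {n : ℕ} → (b : Vec Bool n) → Dec (SelfTwin b)
selfTwin? {n} b = all? (λ j → (3 ≤? suc (toℕ j)) →-dec ((suc (toℕ j) ≤? n ∸ 2) →-dec
                               (lookup b j ≟B lookup b (opposite j))))

SelfTwinWithTypes : {m : ℕ} → ℕ → Vec Bool m → Set
SelfTwinWithTypes k mid = SelfTwin (binRep mid) × numOnes (binRep mid) ≡ k + 2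

selfTwinWithTypes? : {m : ℕ} → (k : ℕ) → (mid : Vec Bool m) → Dec (SelfTwinWithTypes k mid)
selfTwinWithTypes? k mid = selfTwin? (binRep mid) ×-dec (numOnes (binRep mid) ℕP.≟ (k + 2))

Cg : ℕ → ℕ → ℕ
Cg m k = m C k

Γ : ℕ → ℕ → ℕ
Γ m k = length (filter (selfTwinWithTypes? k) (allVecs m))

-- Δ(m,k) = C(m,k) - Γ(m,k), computed in ℤ (no truncated subtraction).
Δ : ℕ → ℕ → ℤ
Δ m k = + Cg m k - + Γ m k

{-# OPTIONS --safe #-}

-- A P game is self twin exactly when its middle bits b₃ … b_{n-2} form a palindrome, and it has two more
-- types than that palindrome has ones; so Γ(m,k) counts binary palindromes of length m with k ones.
-- Stripping the two (equal) outer bits gives Γ(m+2,k+2) = Γ(m,k+2) + Γ(m,k), whence the closed forms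
-- Γ(2a,2b) = C(a,b), Γ(2a,2b+1) = 0 and Γ(2a+1,k) = C(a,⌊k/2⌋): a palindrome is determined by its first
-- half and, for odd length, its middle bit. Compared with Pascal's rule they give
-- Γ(m+1,k+1) = Γ(m,k+1) + Γ(m,k) when m + k is even and Γ(m+1,k+1) + Γ(m,k) = Γ(m,k+1) when it is odd,
-- which is the recurrence for Δ = C − Γ.

module Submission where

open import Defs
open import Data.Nat using (ℕ; suc; _+_; _≤_; _∸_)
open import Data.Nat.Divisibility using (_∣_)
open import Relation.Nullary using (¬_)
open import Data.Integer using (ℤ; +_) renaming (_+_ to _+ℤ_; _*_ to _*ℤ_)
open import Data.Product using (_×_)
open import Relation.Binary.PropositionalEquality using (_≡_)

open import Data.Bool using (Bool; true; false)
open import Data.Bool.Properties using () renaming (_≟_ to _≟B_)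
open import Data.Nat using (zero; _<_; z≤n; s≤s; ⌊_/2⌋; parity)
open import Data.Nat.Properties as ℕ using (+-suc; +-comm; +-identityʳ; suc-injective)
open import Data.Nat.Combinatorics using (_C_; nCn≡1; nCk+nC[k+1]≡[n+1]C[k+1])
open import Data.Nat.Divisibility using (divides; _∣0; ∣-refl; ∣m∣n⇒∣m+n)
open import Data.Parity.Base using (0ℙ; 1ℙ; _⁻¹) renaming (_+_ to _+ℙ_)
open import Data.Parity.Properties as ParityP using (suc-homo-⁻¹; +-homo-+; *-homo-*; *-zeroʳ; ⁻¹-selfInverse)
open import Data.Fin using (Fin; zero; suc; toℕ; opposite; fromℕ; inject₁; fromℕ<; _↑ˡ_)
open import Data.Fin.Properties using (toℕ-injective; toℕ-↑ˡ; toℕ<n; toℕ-fromℕ<; opposite-prop; opposite-involutive)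
open import Data.Vec using (Vec; []; _∷_; _++_; _∷ʳ_; lookup; reverse; tabulate)
open import Data.Vec.Properties using (∷-injective; ∷ʳ-injectiveˡ; reverse-∷; ≡-dec; lookup-++ˡ; tabulate∘lookup; tabulate-cong)
open import Data.List using (List; []; _∷_; filter; length; concatMap)
open import Data.List.Properties using (filter-≐; filter-none)
open import Data.List.Relation.Unary.All using (universal)
open import Data.Integer using (_-_)
open import Data.Integer.Properties using (pos-+)
open import Data.Integer.Tactic.RingSolver using (solve-∀)
open import Data.Empty using (⊥-elim)
open import Data.Product using (_,_; proj₁; proj₂)
open import Function using (_∘_)
open import Relation.Nullary using (does)
open import Relation.Nullary.Decidable using (_×-dec_)
open import Relation.Unary using (Decidable; _≐_)
open import Relation.Binary.PropositionalEquality using (_≢_; refl; sym; trans; cong; cong₂; subst; module ≡-Reasoning)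

module _ {m : ℕ} where

  count : {P : Vec Bool m → Set} → Decidable P → ℕ
  count P? = length (filter P? (allVecs m))

  count-≐ : {P Q : Vec Bool m → Set} (P? : Decidable P) (Q? : Decidable Q) →
            P ≐ Q → count P? ≡ count Q?
  count-≐ P? Q? P≐Q = cong length (filter-≐ P? Q? P≐Q (allVecs m))

  count-none : {P : Vec Bool m → Set} (P? : Decidable P) → (∀ v → ¬ P v) → count P? ≡ 0
  count-none P? ¬P = cong length (filter-none P? (universal ¬P (allVecs m)))

length-filter-concatMap-pair : {A B : Set} {P : B → Set} (P? : Decidable P) (f g : A → B) (xs : List A) →
  length (filter P? (concatMap (λ x → f x ∷ g x ∷ []) xs)) ≡
  length (filter (P? ∘ f) xs) + length (filter (P? ∘ g) xs)
length-filter-concatMap-pair P? f g [] = refl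
-- The test on g x only surfaces once filter has passed f x, hence the nested with.
length-filter-concatMap-pair P? f g (x ∷ xs)
  with does (P? (f x)) | length-filter-concatMap-pair P? f g xs
... | true  | ih with does (P? (g x))
...   | true  = cong suc (trans (cong suc ih) (sym (+-suc _ _)))
...   | false = cong suc ih
length-filter-concatMap-pair P? f g (x ∷ xs) | false | ih with does (P? (g x))
...   | true  = trans (cong suc ih) (sym (+-suc _ _))
...   | false = ih

count-∷ : ∀ {m} {P : Vec Bool (suc m) → Set} (P? : Decidable P) →
          count P? ≡ count (P? ∘ (false ∷_)) + count (P? ∘ (true ∷_))
count-∷ {m} P? = length-filter-concatMap-pair P? (false ∷_) (true ∷_) (allVecs m)

count-∷ʳ : ∀ {m} {P : Vec Bool (suc m) → Set} (P? : Decidable P) →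
           count P? ≡ count (P? ∘ (_∷ʳ false)) + count (P? ∘ (_∷ʳ true))
count-∷ʳ {zero} P? =
  trans (count-∷ P?) (cong₂ _+_ (count-∷≡count-∷ʳ false) (count-∷≡count-∷ʳ true))
  where
  count-∷≡count-∷ʳ : ∀ b → count (P? ∘ (b ∷_)) ≡ count (P? ∘ (_∷ʳ b))
  count-∷≡count-∷ʳ b = count-≐ (P? ∘ (b ∷_)) (P? ∘ (_∷ʳ b)) ((λ { {[]} p → p }) , (λ { {[]} p → p }))
count-∷ʳ {suc m} P? = begin
  count P?
    ≡⟨ count-∷ P? ⟩
  count (P? ∘ (false ∷_)) + count (P? ∘ (true ∷_))
    ≡⟨ cong₂ _+_ (count-∷ʳ (P? ∘ (false ∷_))) (count-∷ʳ (P? ∘ (true ∷_))) ⟩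
  (c false false + c false true) + (c true false + c true true)
    ≡⟨ +-interchange (c false false) (c false true) (c true false) (c true true) ⟩
  (c false false + c true false) + (c false true + c true true)
    ≡⟨ sym (cong₂ _+_ (count-∷ (P? ∘ (_∷ʳ false))) (count-∷ (P? ∘ (_∷ʳ true)))) ⟩
  count (P? ∘ (_∷ʳ false)) + count (P? ∘ (_∷ʳ true)) ∎
  where
  open ≡-Reasoning
  open import Algebra.Properties.CommutativeSemigroup ℕ.+-commutativeSemigroup
    using () renaming (interchange to +-interchange)
  c : Bool → Bool → ℕ
  c x y = count (λ w → P? (x ∷ (w ∷ʳ y)))

count-ends : ∀ {m} {P : Vec Bool (suc (suc m)) → Set} (P? : Decidable P) →
  count P? ≡ (count (λ w → P? (false ∷ (w ∷ʳ false))) + count (λ w → P? (false ∷ (w ∷ʳ true)))) +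
             (count (λ w → P? (true ∷ (w ∷ʳ false))) + count (λ w → P? (true ∷ (w ∷ʳ true))))
count-ends P? = trans (count-∷ P?) (cong₂ _+_ (count-∷ʳ (P? ∘ (false ∷_))) (count-∷ʳ (P? ∘ (true ∷_))))

module _ {A : Set} where

  lookup-∷ʳ-fromℕ : ∀ {n} (xs : Vec A n) x → lookup (xs ∷ʳ x) (fromℕ n) ≡ x
  lookup-∷ʳ-fromℕ []       x = refl
  lookup-∷ʳ-fromℕ (y ∷ xs) x = lookup-∷ʳ-fromℕ xs x

  lookup-∷ʳ-inject₁ : ∀ {n} (xs : Vec A n) x i → lookup (xs ∷ʳ x) (inject₁ i) ≡ lookup xs i
  lookup-∷ʳ-inject₁ (y ∷ xs) x zero    = refl
  lookup-∷ʳ-inject₁ (y ∷ xs) x (suc i) = lookup-∷ʳ-inject₁ xs x i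

  lookup-reverse-opposite : ∀ {n} (xs : Vec A n) i → lookup (reverse xs) (opposite i) ≡ lookup xs i
  lookup-reverse-opposite (x ∷ xs) zero    rewrite reverse-∷ x xs = lookup-∷ʳ-fromℕ (reverse xs) x
  lookup-reverse-opposite (x ∷ xs) (suc i) rewrite reverse-∷ x xs =
    trans (lookup-∷ʳ-inject₁ (reverse xs) x (opposite i)) (lookup-reverse-opposite xs i)

  reverse≡⇒lookup-opposite : ∀ {n} {xs : Vec A n} → reverse xs ≡ xs → ∀ i → lookup xs (opposite i) ≡ lookup xs i
  reverse≡⇒lookup-opposite {xs = xs} rev≡ i =
    trans (cong (λ ys → lookup ys (opposite i)) (sym rev≡)) (lookup-reverse-opposite xs i)

  lookup-opposite⇒reverse≡ : ∀ {n} {xs : Vec A n} → (∀ i → lookup xs (opposite i) ≡ lookup xs i) → reverse xs ≡ xs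
  lookup-opposite⇒reverse≡ {xs = xs} sym-xs = begin
    reverse xs                     ≡⟨ tabulate∘lookup (reverse xs) ⟨
    tabulate (lookup (reverse xs)) ≡⟨ tabulate-cong lookup-reverse ⟩
    tabulate (lookup xs)           ≡⟨ tabulate∘lookup xs ⟩
    xs                             ∎
    where
    open ≡-Reasoning
    lookup-reverse : ∀ i → lookup (reverse xs) i ≡ lookup xs i
    lookup-reverse i = begin
      lookup (reverse xs) i                       ≡⟨ cong (lookup (reverse xs)) (opposite-involutive i) ⟨
      lookup (reverse xs) (opposite (opposite i)) ≡⟨ lookup-reverse-opposite xs (opposite i) ⟩
      lookup xs (opposite i)                      ≡⟨ sym-xs i ⟩
      lookup xs i                                 ∎

  reverse-∷ʳ : ∀ {n} (xs : Vec A n) x → reverse (xs ∷ʳ x) ≡ x ∷ reverse xs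
  reverse-∷ʳ []       x = refl
  reverse-∷ʳ (y ∷ xs) x = begin
    reverse (y ∷ (xs ∷ʳ x))   ≡⟨ reverse-∷ y (xs ∷ʳ x) ⟩
    reverse (xs ∷ʳ x) ∷ʳ y    ≡⟨ cong (_∷ʳ y) (reverse-∷ʳ xs x) ⟩
    x ∷ (reverse xs ∷ʳ y)     ≡⟨ cong (x ∷_) (reverse-∷ y xs) ⟨
    x ∷ reverse (y ∷ xs)      ∎
    where open ≡-Reasoning

  reverse-∷-∷ʳ : ∀ {n} x (xs : Vec A n) y → reverse (x ∷ (xs ∷ʳ y)) ≡ y ∷ (reverse xs ∷ʳ x)
  reverse-∷-∷ʳ x xs y = trans (reverse-∷ x (xs ∷ʳ y)) (cong (_∷ʳ x) (reverse-∷ʳ xs y))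

  palindrome-∷-∷ʳ⁻ : ∀ {n} {x y} {xs : Vec A n} → reverse (x ∷ (xs ∷ʳ y)) ≡ x ∷ (xs ∷ʳ y) →
                     y ≡ x × reverse xs ≡ xs
  palindrome-∷-∷ʳ⁻ {x = x} {y} {xs} rev≡ with ∷-injective (trans (sym (reverse-∷-∷ʳ x xs y)) rev≡)
  ... | y≡x , rev∷ʳ≡ = y≡x , ∷ʳ-injectiveˡ (reverse xs) xs rev∷ʳ≡

  palindrome-∷-∷ʳ⁺ : ∀ {n} x {xs : Vec A n} → reverse xs ≡ xs → reverse (x ∷ (xs ∷ʳ x)) ≡ x ∷ (xs ∷ʳ x)
  palindrome-∷-∷ʳ⁺ x {xs} rev≡ = trans (reverse-∷-∷ʳ x xs x) (cong (λ ys → x ∷ (ys ∷ʳ x)) rev≡)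

fromℕ<-↑ˡ : ∀ {m} n (j : Fin (m + n)) (j<m : toℕ j < m) → fromℕ< j<m ↑ˡ n ≡ j
fromℕ<-↑ˡ n j j<m = toℕ-injective (trans (toℕ-↑ˡ (fromℕ< j<m) n) (toℕ-fromℕ< j<m))

opposite-middle : ∀ {m} (i : Fin m) → opposite {players m} (suc (suc (i ↑ˡ 2))) ≡ suc (suc (opposite i ↑ˡ 2))
opposite-middle {m} i = toℕ-injective (begin
  toℕ (opposite (suc (suc (i ↑ˡ 2)))) ≡⟨ opposite-prop (suc (suc (i ↑ˡ 2))) ⟩
  (m + 2) ∸ suc (toℕ (i ↑ˡ 2))        ≡⟨ cong (λ t → (m + 2) ∸ suc t) (toℕ-↑ˡ i 2) ⟩
  (m + 2) ∸ suc (toℕ i)               ≡⟨ ℕ.+-∸-comm 2 (toℕ<n i) ⟩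
  (m ∸ suc (toℕ i)) + 2               ≡⟨ +-comm (m ∸ suc (toℕ i)) 2 ⟩
  2 + (m ∸ suc (toℕ i))               ≡⟨ cong (λ t → 2 + t) (opposite-prop i) ⟨
  2 + toℕ (opposite i)                ≡⟨ cong (λ t → 2 + t) (toℕ-↑ˡ (opposite i) 2) ⟨
  2 + toℕ (opposite i ↑ˡ 2)           ∎)
  where open ≡-Reasoning

middle-upper-bound : ∀ {m} (i : Fin m) → suc (toℕ (suc (suc (i ↑ˡ 2)))) ≤ players m ∸ 2
middle-upper-bound {m} i = begin
  3 + toℕ (i ↑ˡ 2)  ≡⟨ cong (λ t → 3 + t) (toℕ-↑ˡ i 2) ⟩
  3 + toℕ i         ≡⟨ +-comm 2 (suc (toℕ i)) ⟩
  suc (toℕ i) + 2   ≤⟨ ℕ.+-monoˡ-≤ 2 (toℕ<n i) ⟩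
  m + 2             ∎
  where open ℕ.≤-Reasoning

module _ {m} (mid : Vec Bool m) where

  lookup-binRep-opposite-middle : ∀ i → lookup (binRep mid) (opposite (suc (suc (i ↑ˡ 2)))) ≡ lookup mid (opposite i)
  lookup-binRep-opposite-middle i =
    trans (cong (lookup (binRep mid)) (opposite-middle i)) (lookup-++ˡ mid _ (opposite i))

  selfTwin⇒palindrome : SelfTwin (binRep mid) → reverse mid ≡ mid
  selfTwin⇒palindrome selfTwin = lookup-opposite⇒reverse≡ λ i → begin
    lookup mid (opposite i)                             ≡⟨ lookup-binRep-opposite-middle i ⟨
    lookup (binRep mid) (opposite (suc (suc (i ↑ˡ 2))))
      ≡⟨ selfTwin (suc (suc (i ↑ˡ 2))) (s≤s (s≤s (s≤s z≤n))) (middle-upper-bound i) ⟨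
    lookup (binRep mid) (suc (suc (i ↑ˡ 2)))            ≡⟨ lookup-++ˡ mid _ i ⟩
    lookup mid i                                        ∎
    where open ≡-Reasoning

  palindrome⇒selfTwin : reverse mid ≡ mid → SelfTwin (binRep mid)
  palindrome⇒selfTwin pal zero          (s≤s ())        _
  palindrome⇒selfTwin pal (suc zero)    (s≤s (s≤s ()))  _
  palindrome⇒selfTwin pal (suc (suc j)) _               upper =
    subst (λ j → lookup (binRep mid) (suc (suc j)) ≡ lookup (binRep mid) (opposite (suc (suc j))))
          (fromℕ<-↑ˡ 2 j j<m) (symmetric-middle (fromℕ< j<m))
    where
    j<m : toℕ j < m
    j<m = ℕ.+-cancelʳ-≤ 2 (suc (toℕ j)) m (subst (_≤ m + 2) (+-comm 2 (suc (toℕ j))) upper)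
    open ≡-Reasoning
    symmetric-middle : ∀ i → lookup (binRep mid) (suc (suc (i ↑ˡ 2))) ≡ lookup (binRep mid) (opposite (suc (suc (i ↑ˡ 2))))
    symmetric-middle i = begin
      lookup (binRep mid) (suc (suc (i ↑ˡ 2)))            ≡⟨ lookup-++ˡ mid _ i ⟩
      lookup mid i                                        ≡⟨ reverse≡⇒lookup-opposite pal i ⟨
      lookup mid (opposite i)                             ≡⟨ lookup-binRep-opposite-middle i ⟨
      lookup (binRep mid) (opposite (suc (suc (i ↑ˡ 2)))) ∎

numOnes-++ : ∀ {m n} (xs : Vec Bool m) (ys : Vec Bool n) → numOnes (xs ++ ys) ≡ numOnes xs + numOnes ys
numOnes-++ []           ys = refl
numOnes-++ (true  ∷ xs) ys = cong suc (numOnes-++ xs ys)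
numOnes-++ (false ∷ xs) ys = numOnes-++ xs ys

numOnes-∷ʳ : ∀ {n} (xs : Vec Bool n) x → numOnes (xs ∷ʳ x) ≡ numOnes (x ∷ xs)
numOnes-∷ʳ []           x     = refl
numOnes-∷ʳ (false ∷ xs) false = numOnes-∷ʳ xs false
numOnes-∷ʳ (false ∷ xs) true  = numOnes-∷ʳ xs true
numOnes-∷ʳ (true  ∷ xs) false = cong suc (numOnes-∷ʳ xs false)
numOnes-∷ʳ (true  ∷ xs) true  = cong suc (numOnes-∷ʳ xs true)

numOnes-binRep : ∀ {m} (mid : Vec Bool m) → numOnes (binRep mid) ≡ numOnes mid + 2
numOnes-binRep mid = trans (cong suc (numOnes-++ mid (false ∷ true ∷ []))) (sym (+-suc (numOnes mid) 1))

PalindromeWithOnes : ∀ {m} → ℕ → Vec Bool m → Set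
PalindromeWithOnes k v = reverse v ≡ v × numOnes v ≡ k

palindromeWithOnes? : ∀ {m} k → Decidable (PalindromeWithOnes {m} k)
palindromeWithOnes? k v = ≡-dec _≟B_ (reverse v) v ×-dec numOnes v ℕ.≟ k

palindromes : ℕ → ℕ → ℕ
palindromes m k = count {m} (palindromeWithOnes? k)

selfTwinWithTypes≐palindromeWithOnes : ∀ {m} k → SelfTwinWithTypes {m} k ≐ PalindromeWithOnes k
selfTwinWithTypes≐palindromeWithOnes k =
  (λ { {mid} (selfTwin , types) →
         selfTwin⇒palindrome mid selfTwin , ℕ.+-cancelʳ-≡ 2 _ _ (trans (sym (numOnes-binRep mid)) types) }) ,
  (λ { {mid} (pal , ones) → palindrome⇒selfTwin mid pal , trans (numOnes-binRep mid) (cong (_+ 2) ones) })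

Γ≡palindromes : ∀ m k → Γ m k ≡ palindromes m k
Γ≡palindromes m k = count-≐ {m} (selfTwinWithTypes? k) (palindromeWithOnes? k) (selfTwinWithTypes≐palindromeWithOnes k)

numOnes-∷-∷ʳ : ∀ {n} x (xs : Vec Bool n) → numOnes (x ∷ (xs ∷ʳ x)) ≡ numOnes (x ∷ x ∷ xs)
numOnes-∷-∷ʳ false xs = numOnes-∷ʳ xs false
numOnes-∷-∷ʳ true  xs = cong suc (numOnes-∷ʳ xs true)

palindromes-ends : ∀ m k →
  palindromes (2 + m) k ≡ palindromes m k + count {m} (λ w → palindromeWithOnes? k (true ∷ (w ∷ʳ true)))
palindromes-ends m k = begin
  palindromes (2 + m) k
    ≡⟨ count-ends {m} (palindromeWithOnes? k) ⟩
  (c false false + c false true) + (c true false + c true true)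
    ≡⟨ cong₂ (λ a b → (a + b) + (c true false + c true true)) false-ends (no-palindromes λ ()) ⟩
  (palindromes m k + 0) + (c true false + c true true)
    ≡⟨ cong₂ (λ a b → a + (b + c true true)) (+-identityʳ _) (no-palindromes λ ()) ⟩
  palindromes m k + c true true ∎
  where
  open ≡-Reasoning
  c : Bool → Bool → ℕ
  c x y = count {m} (λ w → palindromeWithOnes? k (x ∷ (w ∷ʳ y)))
  no-palindromes : ∀ {x y} → y ≢ x → c x y ≡ 0
  no-palindromes y≢x = count-none {m} _ λ _ (pal , _) → y≢x (proj₁ (palindrome-∷-∷ʳ⁻ pal))
  false-ends : c false false ≡ palindromes m k
  false-ends = count-≐ {m} _ (palindromeWithOnes? k)
    ( (λ { {w} (pal , ones) → proj₂ (palindrome-∷-∷ʳ⁻ pal) , trans (sym (numOnes-∷-∷ʳ false w)) ones })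
    , (λ { {w} (pal , ones) → palindrome-∷-∷ʳ⁺ false pal , trans (numOnes-∷-∷ʳ false w) ones }))

palindromes-2+-2+ : ∀ m k → palindromes (2 + m) (2 + k) ≡ palindromes m (2 + k) + palindromes m k
palindromes-2+-2+ m k = trans (palindromes-ends m (2 + k)) (cong (_+_ (palindromes m (2 + k))) true-ends)
  where
  true-ends : count {m} (λ w → palindromeWithOnes? (2 + k) (true ∷ (w ∷ʳ true))) ≡ palindromes m k
  true-ends = count-≐ {m} _ (palindromeWithOnes? k)
    ( (λ { {w} (pal , ones) →
             proj₂ (palindrome-∷-∷ʳ⁻ pal) , suc-injective (suc-injective (trans (sym (numOnes-∷-∷ʳ true w)) ones)) })
    , (λ { {w} (pal , ones) → palindrome-∷-∷ʳ⁺ true pal , trans (numOnes-∷-∷ʳ true w) (cong (λ t → 2 + t) ones) }))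

palindromes-2+-<2 : ∀ m k → k < 2 → palindromes (2 + m) k ≡ palindromes m k
palindromes-2+-<2 m k k<2 =
  trans (palindromes-ends m k) (trans (cong (_+_ (palindromes m k)) (count-none {m} _ too-few-ones)) (+-identityʳ _))
  where
  too-few-ones : ∀ w → ¬ PalindromeWithOnes k (true ∷ (w ∷ʳ true))
  too-few-ones w (_ , ones) = ℕ.<⇒≱ k<2 (subst (2 ≤_) (trans (sym (numOnes-∷-∷ʳ true w)) ones) (s≤s (s≤s z≤n)))

nC[k+1]+nCk≡[n+1]C[k+1] : ∀ n k → n C suc k + n C k ≡ suc n C suc k
nC[k+1]+nCk≡[n+1]C[k+1] n k = trans (+-comm (n C suc k) (n C k)) (nCk+nC[k+1]≡[n+1]C[k+1] n k)

palindromes-even-even : ∀ m k → parity m ≡ 0ℙ → parity k ≡ 0ℙ → palindromes m k ≡ ⌊ m /2⌋ C ⌊ k /2⌋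
palindromes-even-even zero          zero          _  _  = refl
palindromes-even-even zero          (suc (suc k)) _  _  = refl
palindromes-even-even (suc (suc m)) zero          pm pk =
  trans (palindromes-2+-<2 m 0 (s≤s z≤n)) (palindromes-even-even m 0 pm pk)
palindromes-even-even (suc (suc m)) (suc (suc k)) pm pk = begin
  palindromes (2 + m) (2 + k)               ≡⟨ palindromes-2+-2+ m k ⟩
  palindromes m (2 + k) + palindromes m k   ≡⟨ cong₂ _+_ (palindromes-even-even m (2 + k) pm pk) (palindromes-even-even m k pm pk) ⟩
  ⌊ m /2⌋ C suc ⌊ k /2⌋ + ⌊ m /2⌋ C ⌊ k /2⌋ ≡⟨ nC[k+1]+nCk≡[n+1]C[k+1] ⌊ m /2⌋ ⌊ k /2⌋ ⟩
  suc ⌊ m /2⌋ C suc ⌊ k /2⌋                 ∎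
  where open ≡-Reasoning

palindromes-even-odd : ∀ m k → parity m ≡ 0ℙ → parity k ≡ 1ℙ → palindromes m k ≡ 0
palindromes-even-odd zero          (suc zero)    _  _  = refl
palindromes-even-odd zero          (suc (suc k)) _  _  = refl
palindromes-even-odd (suc (suc m)) (suc zero)    pm pk =
  trans (palindromes-2+-<2 m 1 (s≤s (s≤s z≤n))) (palindromes-even-odd m 1 pm pk)
palindromes-even-odd (suc (suc m)) (suc (suc k)) pm pk =
  trans (palindromes-2+-2+ m k) (cong₂ _+_ (palindromes-even-odd m (2 + k) pm pk) (palindromes-even-odd m k pm pk))

palindromes-odd : ∀ m k → parity m ≡ 1ℙ → palindromes m k ≡ ⌊ m /2⌋ C ⌊ k /2⌋
palindromes-odd (suc zero)    zero          _  = refl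
palindromes-odd (suc zero)    (suc zero)    _  = refl
palindromes-odd (suc zero)    (suc (suc k)) _  = refl
palindromes-odd (suc (suc m)) zero          pm = trans (palindromes-2+-<2 m 0 (s≤s z≤n)) (palindromes-odd m 0 pm)
palindromes-odd (suc (suc m)) (suc zero)    pm = trans (palindromes-2+-<2 m 1 (s≤s (s≤s z≤n))) (palindromes-odd m 1 pm)
palindromes-odd (suc (suc m)) (suc (suc k)) pm = begin
  palindromes (2 + m) (2 + k)               ≡⟨ palindromes-2+-2+ m k ⟩
  palindromes m (2 + k) + palindromes m k   ≡⟨ cong₂ _+_ (palindromes-odd m (2 + k) pm) (palindromes-odd m k pm) ⟩
  ⌊ m /2⌋ C suc ⌊ k /2⌋ + ⌊ m /2⌋ C ⌊ k /2⌋ ≡⟨ nC[k+1]+nCk≡[n+1]C[k+1] ⌊ m /2⌋ ⌊ k /2⌋ ⟩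
  suc ⌊ m /2⌋ C suc ⌊ k /2⌋                 ∎
  where open ≡-Reasoning

parity-suc : ∀ n {p} → parity n ≡ p → parity (suc n) ≡ p ⁻¹
parity-suc n refl = sym (⁻¹-selfInverse (suc-homo-⁻¹ n))

⌊1+n/2⌋-even : ∀ n → parity n ≡ 0ℙ → ⌊ suc n /2⌋ ≡ ⌊ n /2⌋
⌊1+n/2⌋-even zero          _  = refl
⌊1+n/2⌋-even (suc (suc n)) pn = cong suc (⌊1+n/2⌋-even n pn)

⌊1+n/2⌋-odd : ∀ n → parity n ≡ 1ℙ → ⌊ suc n /2⌋ ≡ suc ⌊ n /2⌋
⌊1+n/2⌋-odd (suc zero)    _  = refl
⌊1+n/2⌋-odd (suc (suc n)) pn = cong suc (⌊1+n/2⌋-odd n pn)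

2∣⇒parity≡0ℙ : ∀ {n} → 2 ∣ n → parity n ≡ 0ℙ
2∣⇒parity≡0ℙ (divides q refl) = trans (*-homo-* q 2) (*-zeroʳ (parity q))

parity≡0ℙ⇒2∣ : ∀ n → parity n ≡ 0ℙ → 2 ∣ n
parity≡0ℙ⇒2∣ zero          _  = 2 ∣0
parity≡0ℙ⇒2∣ (suc (suc n)) pn = ∣m∣n⇒∣m+n (∣-refl {2}) (parity≡0ℙ⇒2∣ n pn)

¬2∣⇒parity≡1ℙ : ∀ n → ¬ 2 ∣ n → parity n ≡ 1ℙ
¬2∣⇒parity≡1ℙ n ¬2∣n with parity n in pn
... | 0ℙ = ⊥-elim (¬2∣n (parity≡0ℙ⇒2∣ n pn))
... | 1ℙ = refl

parity-suc-+-suc : ∀ m n → parity (suc m + suc n) ≡ parity m +ℙ parity n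
parity-suc-+-suc m n = trans (cong (parity ∘ suc) (+-suc m n)) (+-homo-+ m n)

2∣1+m+1+n⇒parity≡ : ∀ m n → 2 ∣ suc m + suc n → parity m ≡ parity n
2∣1+m+1+n⇒parity≡ m n 2∣ = ParityP.+-cancelʳ-≡ (parity n) (parity m) (parity n)
  (trans (trans (sym (parity-suc-+-suc m n)) (2∣⇒parity≡0ℙ 2∣)) (sym (ParityP.p+p≡0ℙ (parity n))))

¬2∣1+m+1+n⇒parity≡⁻¹ : ∀ m n → ¬ 2 ∣ suc m + suc n → parity m ≡ parity n ⁻¹
¬2∣1+m+1+n⇒parity≡⁻¹ m n ¬2∣ = ParityP.+-cancelʳ-≡ (parity n) (parity m) (parity n ⁻¹)
  (trans (trans (sym (parity-suc-+-suc m n)) (¬2∣⇒parity≡1ℙ _ ¬2∣)) (sym (ParityP.p⁻¹+p≡1ℙ (parity n))))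

-- In the mixed-parity cases the with-abstracted hypothesis reads 0ℙ ≡ 1ℙ, so they are absurd.
palindromes-same-parity : ∀ m k → parity m ≡ parity k →
  palindromes (suc m) (suc k) ≡ palindromes m (suc k) + palindromes m k
palindromes-same-parity m k _ with parity m in pm | parity k in pk
... | 0ℙ | 0ℙ = begin
  palindromes (suc m) (suc k)   ≡⟨ palindromes-odd (suc m) (suc k) (parity-suc m pm) ⟩
  ⌊ suc m /2⌋ C ⌊ suc k /2⌋     ≡⟨ cong₂ _C_ (⌊1+n/2⌋-even m pm) (⌊1+n/2⌋-even k pk) ⟩
  ⌊ m /2⌋ C ⌊ k /2⌋             ≡⟨ palindromes-even-even m k pm pk ⟨
  palindromes m k               ≡⟨ cong (_+ palindromes m k) (palindromes-even-odd m (suc k) pm (parity-suc k pk)) ⟨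
  palindromes m (suc k) + palindromes m k ∎
  where open ≡-Reasoning
... | 1ℙ | 1ℙ = begin
  palindromes (suc m) (suc k)   ≡⟨ palindromes-even-even (suc m) (suc k) (parity-suc m pm) (parity-suc k pk) ⟩
  ⌊ suc m /2⌋ C ⌊ suc k /2⌋     ≡⟨ cong₂ _C_ (⌊1+n/2⌋-odd m pm) (⌊1+n/2⌋-odd k pk) ⟩
  suc ⌊ m /2⌋ C suc ⌊ k /2⌋     ≡⟨ nC[k+1]+nCk≡[n+1]C[k+1] ⌊ m /2⌋ ⌊ k /2⌋ ⟨
  ⌊ m /2⌋ C suc ⌊ k /2⌋ + ⌊ m /2⌋ C ⌊ k /2⌋
    ≡⟨ cong₂ _+_ (trans (palindromes-odd m (suc k) pm) (cong (⌊ m /2⌋ C_) (⌊1+n/2⌋-odd k pk))) (palindromes-odd m k pm) ⟨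
  palindromes m (suc k) + palindromes m k ∎
  where open ≡-Reasoning

palindromes-opposite-parity : ∀ m k → parity m ≡ parity k ⁻¹ →
  palindromes (suc m) (suc k) + palindromes m k ≡ palindromes m (suc k)
palindromes-opposite-parity m k _ with parity m in pm | parity k in pk
... | 0ℙ | 1ℙ = begin
  palindromes (suc m) (suc k) + palindromes m k
    ≡⟨ cong₂ _+_ (palindromes-odd (suc m) (suc k) (parity-suc m pm)) (palindromes-even-odd m k pm pk) ⟩
  ⌊ suc m /2⌋ C ⌊ suc k /2⌋ + 0 ≡⟨ +-identityʳ _ ⟩
  ⌊ suc m /2⌋ C ⌊ suc k /2⌋     ≡⟨ cong (_C ⌊ suc k /2⌋) (⌊1+n/2⌋-even m pm) ⟩
  ⌊ m /2⌋ C ⌊ suc k /2⌋         ≡⟨ palindromes-even-even m (suc k) pm (parity-suc k pk) ⟨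
  palindromes m (suc k)         ∎
  where open ≡-Reasoning
... | 1ℙ | 0ℙ = begin
  palindromes (suc m) (suc k) + palindromes m k
    ≡⟨ cong (_+ palindromes m k) (palindromes-even-odd (suc m) (suc k) (parity-suc m pm) (parity-suc k pk)) ⟩
  palindromes m k               ≡⟨ palindromes-odd m k pm ⟩
  ⌊ m /2⌋ C ⌊ k /2⌋             ≡⟨ cong (⌊ m /2⌋ C_) (⌊1+n/2⌋-even k pk) ⟨
  ⌊ m /2⌋ C ⌊ suc k /2⌋         ≡⟨ palindromes-odd m (suc k) pm ⟨
  palindromes m (suc k)         ∎
  where open ≡-Reasoning

palindromes-zero : ∀ m → palindromes m 0 ≡ 1
palindromes-zero m with parity m in pm
... | 0ℙ = palindromes-even-even m 0 pm refl
... | 1ℙ = palindromes-odd m 0 pm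

palindromes-diagonal : ∀ m → palindromes m m ≡ 1
palindromes-diagonal m with parity m in pm
... | 0ℙ = trans (palindromes-even-even m m pm pm) (nCn≡1 ⌊ m /2⌋)
... | 1ℙ = trans (palindromes-odd m m pm) (nCn≡1 ⌊ m /2⌋)

Δ-via-palindromes : ∀ m k → Δ m k ≡ + (m C k) - + palindromes m k
Δ-via-palindromes m k = cong (λ g → + (m C k) - + g) (Γ≡palindromes m k)

pos-+-−-interchange : ∀ a b c d → + (a + b) - + (c + d) ≡ (+ b - + c) +ℤ (+ a - + d)
pos-+-−-interchange a b c d rewrite pos-+ a b | pos-+ c d = interchange (+ a) (+ b) (+ c) (+ d)
  where interchange : ∀ (a b c d : ℤ) → (a +ℤ b) - (c +ℤ d) ≡ (b - c) +ℤ (a - d)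
        interchange = solve-∀

pos-+-−-split : ∀ a b c d → + (a + b) - + c ≡ (+ b - + (c + d)) +ℤ (+ a - + d) +ℤ + 2 *ℤ + d
pos-+-−-split a b c d rewrite pos-+ a b | pos-+ c d = split (+ a) (+ b) (+ c) (+ d)
  where split : ∀ (a b c d : ℤ) → (a +ℤ b) - c ≡ (b - (c +ℤ d)) +ℤ (a - d) +ℤ + 2 *ℤ d
        split = solve-∀

Δ-zero : ∀ m → Δ m 0 ≡ + 0
Δ-zero m = trans (Δ-via-palindromes m 0) (cong (λ g → + 1 - + g) (palindromes-zero m))

Δ-diagonal : ∀ m → Δ m m ≡ + 0
Δ-diagonal m = trans (Δ-via-palindromes m m) (cong₂ (λ c g → + c - + g) (nCn≡1 m) (palindromes-diagonal m))

Δ-pascal-even : ∀ m k → 2 ∣ suc m + suc k → Δ (suc m) (suc k) ≡ Δ m (suc k) +ℤ Δ m k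
Δ-pascal-even m k 2∣ = begin
  Δ (suc m) (suc k)
    ≡⟨ Δ-via-palindromes (suc m) (suc k) ⟩
  + (suc m C suc k) - + palindromes (suc m) (suc k)
    ≡⟨ cong₂ (λ c g → + c - + g) (sym (nCk+nC[k+1]≡[n+1]C[k+1] m k))
             (palindromes-same-parity m k (2∣1+m+1+n⇒parity≡ m k 2∣)) ⟩
  + (m C k + m C suc k) - + (palindromes m (suc k) + palindromes m k)
    ≡⟨ pos-+-−-interchange (m C k) (m C suc k) (palindromes m (suc k)) (palindromes m k) ⟩
  (+ (m C suc k) - + palindromes m (suc k)) +ℤ (+ (m C k) - + palindromes m k)
    ≡⟨ cong₂ _+ℤ_ (Δ-via-palindromes m (suc k)) (Δ-via-palindromes m k) ⟨
  Δ m (suc k) +ℤ Δ m k ∎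
  where open ≡-Reasoning

Δ-pascal-odd : ∀ m k → ¬ 2 ∣ suc m + suc k → Δ (suc m) (suc k) ≡ Δ m (suc k) +ℤ Δ m k +ℤ + 2 *ℤ + Γ m k
Δ-pascal-odd m k ¬2∣ = begin
  Δ (suc m) (suc k)                                    ≡⟨ Δ-via-palindromes (suc m) (suc k) ⟩
  + (suc m C suc k) - + P′                             ≡⟨ cong (λ c → + c - + P′) (nCk+nC[k+1]≡[n+1]C[k+1] m k) ⟨
  + (m C k + m C suc k) - + P′                         ≡⟨ pos-+-−-split (m C k) (m C suc k) P′ P₀ ⟩
  (+ (m C suc k) - + (P′ + P₀)) +ℤ Δ₀ +ℤ + 2 *ℤ + P₀
    ≡⟨ cong (λ g → (+ (m C suc k) - + g) +ℤ Δ₀ +ℤ + 2 *ℤ + P₀)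
            (palindromes-opposite-parity m k (¬2∣1+m+1+n⇒parity≡⁻¹ m k ¬2∣)) ⟩
  (+ (m C suc k) - + P₁) +ℤ Δ₀ +ℤ + 2 *ℤ + P₀
    ≡⟨ cong₂ (λ x g → x +ℤ Δ₀ +ℤ + 2 *ℤ + g) (Δ-via-palindromes m (suc k)) (Γ≡palindromes m k) ⟨
  Δ m (suc k) +ℤ Δ₀ +ℤ + 2 *ℤ + Γ m k
    ≡⟨ cong (λ x → Δ m (suc k) +ℤ x +ℤ + 2 *ℤ + Γ m k) (Δ-via-palindromes m k) ⟨
  Δ m (suc k) +ℤ Δ m k +ℤ + 2 *ℤ + Γ m k               ∎
  where
  open ≡-Reasoning
  P′ P₀ P₁ : ℕ
  P′ = palindromes (suc m) (suc k)
  P₀ = palindromes m k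
  P₁ = palindromes m (suc k)
  Δ₀ : ℤ
  Δ₀ = + (m C k) - + P₀

mainTheorem4 :
    (∀ (m : ℕ) → Δ m 0 ≡ + 0 × Δ m m ≡ + 0) ×
    (∀ (m k : ℕ) → 2 ≤ m → 1 ≤ k → k ≤ m ∸ 1 →
      (2 ∣ m + k → Δ m k ≡ Δ (m ∸ 1) k +ℤ Δ (m ∸ 1) (k ∸ 1)) ×
      (¬ (2 ∣ m + k) → Δ m k ≡ Δ (m ∸ 1) k +ℤ Δ (m ∸ 1) (k ∸ 1) +ℤ + 2 *ℤ + Γ (m ∸ 1) (k ∸ 1)))
mainTheorem4 =
  (λ m → Δ-zero m , Δ-diagonal m) ,
  λ { (suc m) (suc k) _ _ _ → Δ-pascal-even m k , Δ-pascal-odd m k }
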